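{- Let $\varphi$ be an LTL formula in negation normal form and let $w$ be an infinite word over $2^{Ap}$. For every $X \subseteq \mu(\varphi)$: (a1) if $\mathcal{F}_w \subseteq X$ and $w \models \varphi$, then $w \models \varphi[X]_\nu$; (a2) if $X \subseteq \mathcal{GF}_w$ and $w \models \varphi[X]_\nu$, then $w \models \varphi$; (a3) in particular, if $\mathcal{F}_w = X = \mathcal{GF}_w$, then $w \models \varphi$ iff $w \models \varphi[X]_\nu$. For every $Y \subseteq \nu(\varphi)$: (b1) if $\mathcal{FG}_w \subseteq Y$ and $w \models \varphi$, then $w \models \varphi[Y]_\mu$; (b2) if $Y \subseteq \mathcal{G}_w$ and $w \models \varphi[Y]_\mu$, then $w \models \varphi$; (b3) in particular, if $\mathcal{FG}_w = Y = \mathcal{G}_w$, then $w \models \varphi$ iff $w \models \varphi[Y]_\mu$.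
   Context: LTL formulas in negation normal form over a finite set $Ap$: $\varphi ::= \mathbf{tt} \mid \mathbf{ff} \mid a \mid \neg a \mid \varphi\wedge\varphi \mid \varphi\vee\varphi \mid \mathbf{X}\varphi \mid \mathbf{F}\varphi \mid \mathbf{G}\varphi \mid \varphi\mathbf{U}\varphi \mid \varphi\mathbf{W}\varphi \mid \varphi\mathbf{M}\varphi \mid \varphi\mathbf{R}\varphi$, with standard semantics on infinite words ($\varphi\mathbf{W}\psi\equiv\mathbf{G}\varphi\vee\varphi\mathbf{U}\psi$; $w\models\varphi\mathbf{M}\psi$ iff $\exists k.\,w_k\models\varphi \wedge \forall j\le k.\,w_j\models\psi$; $\varphi\mathbf{R}\psi\equiv\mathbf{G}\psi\vee\varphi\mathbf{M}\psi$). $\mu(\varphi)$ is the set of subformulas of $\varphi$ of the form $\mathbf{F}\psi$, $\psi_1\mathbf{U}\psi_2$, $\psi_1\mathbf{M}\psi_2$; $\nu(\varphi)$ the set of subformulas of the form $\mathbf{G}\psi$, $\psi_1\mathbf{W}\psi_2$, $\psi_1\mathbf{R}\psi_2$. $\mathcal{GF}_w=\{\psi\in\mu(\varphi)\mid w\models\mathbf{G}\mathbf{F}\psi\}$, $\mathcal{F}_w=\{\psi\in\mu(\varphi)\mid w\models\mathbf{F}\psi\}$, $\mathcal{FG}_w=\{\psi\in\nu(\varphi)\mid w\models\mathbf{F}\mathbf{G}\psi\}$, $\mathcal{G}_w=\{\psi\in\nu(\varphi)\mid w\models\mathbf{G}\psi\}$. For a set $X$ of formulas, $\psi[X]_\nu$: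 it is $\psi$ for $\psi\in\{\mathbf{tt},\mathbf{ff},a,\neg a\}$; it commutes with $\mathbf{X},\mathbf{G},\wedge,\vee,\mathbf{W},\mathbf{R}$; $(\mathbf{F}\psi)[X]_\nu=\mathbf{tt}$ if $\mathbf{F}\psi\in X$, else $\mathbf{ff}$; $(\psi_1\mathbf{U}\psi_2)[X]_\nu=(\psi_1[X]_\nu)\mathbf{W}(\psi_2[X]_\nu)$ if $\psi_1\mathbf{U}\psi_2\in X$, else $\mathbf{ff}$; $(\psi_1\mathbf{M}\psi_2)[X]_\nu=(\psi_1[X]_\nu)\mathbf{R}(\psi_2[X]_\nu)$ if $\psi_1\mathbf{M}\psi_2\in X$, else $\mathbf{ff}$. For a set $Y$ of formulas, $\psi[Y]_\mu$: it is $\psi$ for $\psi\in\{\mathbf{tt},\mathbf{ff},a,\neg a\}$; it commutes with $\mathbf{X},\mathbf{F},\wedge,\vee,\mathbf{U},\mathbf{M}$; $(\mathbf{G}\psi)[Y]_\mu=\mathbf{tt}$ if $\mathbf{G}\psi\in Y$, else $\mathbf{ff}$; $(\psi_1\mathbf{W}\psi_2)[Y]_\mu=\mathbf{tt}$ if $\psi_1\mathbf{W}\psi_2\in Y$, else $(\psi_1[Y]_\mu)\mathbf{U}(\psi_2[Y]_\mu)$; $(\psi_1\mathbf{R}\psi_2)[Y]_\mu=\mathbf{tt}$ if $\psi_1\mathbf{R}\psi_2\in Y$, else $(\psi_1[Y]_\mu)\mathbf{M}(\psi_2[Y]_\mu)$. -}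

module Defs where

open import Data.Nat using (ℕ; _+_; _<_; _≤_)
open import Data.Fin using (Fin)
open import Data.Fin.Subset using (Subset; _∈_; _∉_)
open import Data.Bool using (Bool; true; false; if_then_else_)
open import Data.Product using (_×_; ∃-syntax)
open import Data.Sum using (_⊎_)
open import Data.Unit using (⊤)
open import Data.Empty using (⊥)
open import Relation.Binary.PropositionalEquality using (_≡_)
open import Relation.Unary using (Pred)
open import Level using (0ℓ)

data LTL (n : ℕ) : Set where
  tt ff : LTL n
  atom natom : Fin n → LTL n
  _∧_ _∨_ : LTL n → LTL n → LTL n
  𝐗 𝐅 𝐆 : LTL n → LTL n
  _𝐔_ _𝐖_ _𝐌_ _𝐑_ : LTL n → LTL n → LTL n

Word : ℕ → Set
Word n = ℕ → Subset n

_↑_ : ∀ {n} → Word n → ℕ → Word n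
(w ↑ i) j = w (i + j)

infix 4 _⊨_
_⊨_ : ∀ {n} → Word n → LTL n → Set
w ⊨ tt = ⊤
w ⊨ ff = ⊥
w ⊨ atom a = a ∈ w 0
w ⊨ natom a = a ∉ w 0
w ⊨ (φ ∧ ψ) = (w ⊨ φ) × (w ⊨ ψ)
w ⊨ (φ ∨ ψ) = (w ⊨ φ) ⊎ (w ⊨ ψ)
w ⊨ 𝐗 φ = (w ↑ 1) ⊨ φ
w ⊨ 𝐅 φ = ∃[ k ] ((w ↑ k) ⊨ φ)
w ⊨ 𝐆 φ = ∀ k → (w ↑ k) ⊨ φ
w ⊨ (φ 𝐔 ψ) = ∃[ k ] (((w ↑ k) ⊨ ψ) × (∀ j → j < k → (w ↑ j) ⊨ φ))
w ⊨ (φ 𝐖 ψ) = (∀ k → (w ↑ k) ⊨ φ)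
             ⊎ ∃[ k ] (((w ↑ k) ⊨ ψ) × (∀ j → j < k → (w ↑ j) ⊨ φ))
w ⊨ (φ 𝐌 ψ) = ∃[ k ] (((w ↑ k) ⊨ φ) × (∀ j → j ≤ k → (w ↑ j) ⊨ ψ))
w ⊨ (φ 𝐑 ψ) = (∀ k → (w ↑ k) ⊨ ψ)
             ⊎ ∃[ k ] (((w ↑ k) ⊨ φ) × (∀ j → j ≤ k → (w ↑ j) ⊨ ψ))

infix 4 _⊑_
data _⊑_ {n} : LTL n → LTL n → Set where
  refl⊑ : ∀ {φ} → φ ⊑ φ
  ∧ˡ : ∀ {ψ φ χ} → ψ ⊑ φ → ψ ⊑ (φ ∧ χ)
  ∧ʳ : ∀ {ψ φ χ} → ψ ⊑ χ → ψ ⊑ (φ ∧ χ)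
  ∨ˡ : ∀ {ψ φ χ} → ψ ⊑ φ → ψ ⊑ (φ ∨ χ)
  ∨ʳ : ∀ {ψ φ χ} → ψ ⊑ χ → ψ ⊑ (φ ∨ χ)
  𝐗⊑ : ∀ {ψ φ} → ψ ⊑ φ → ψ ⊑ 𝐗 φ
  𝐅⊑ : ∀ {ψ φ} → ψ ⊑ φ → ψ ⊑ 𝐅 φ
  𝐆⊑ : ∀ {ψ φ} → ψ ⊑ φ → ψ ⊑ 𝐆 φ
  𝐔ˡ : ∀ {ψ φ χ} → ψ ⊑ φ → ψ ⊑ (φ 𝐔 χ)
  𝐔ʳ : ∀ {ψ φ χ} → ψ ⊑ χ → ψ ⊑ (φ 𝐔 χ)
  𝐖ˡ : ∀ {ψ φ χ} → ψ ⊑ φ → ψ ⊑ (φ 𝐖 χ)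
  𝐖ʳ : ∀ {ψ φ χ} → ψ ⊑ χ → ψ ⊑ (φ 𝐖 χ)
  𝐌ˡ : ∀ {ψ φ χ} → ψ ⊑ φ → ψ ⊑ (φ 𝐌 χ)
  𝐌ʳ : ∀ {ψ φ χ} → ψ ⊑ χ → ψ ⊑ (φ 𝐌 χ)
  𝐑ˡ : ∀ {ψ φ χ} → ψ ⊑ φ → ψ ⊑ (φ 𝐑 χ)
  𝐑ʳ : ∀ {ψ φ χ} → ψ ⊑ χ → ψ ⊑ (φ 𝐑 χ)

data IsMu {n} : LTL n → Set where
  isF : ∀ {φ} → IsMu (𝐅 φ)
  isU : ∀ {φ ψ} → IsMu (φ 𝐔 ψ)
  isM : ∀ {φ ψ} → IsMu (φ 𝐌 ψ)

data IsNu {n} : LTL n → Set where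
  isG : ∀ {φ} → IsNu (𝐆 φ)
  isW : ∀ {φ ψ} → IsNu (φ 𝐖 ψ)
  isR : ∀ {φ ψ} → IsNu (φ 𝐑 ψ)

μ : ∀ {n} → LTL n → Pred (LTL n) 0ℓ
μ φ ψ = (ψ ⊑ φ) × IsMu ψ

ν : ∀ {n} → LTL n → Pred (LTL n) 0ℓ
ν φ ψ = (ψ ⊑ φ) × IsNu ψ

GF[_,_] : ∀ {n} → LTL n → Word n → Pred (LTL n) 0ℓ
GF[ φ , w ] ψ = μ φ ψ × (w ⊨ 𝐆 (𝐅 ψ))

F[_,_] : ∀ {n} → LTL n → Word n → Pred (LTL n) 0ℓ
F[ φ , w ] ψ = μ φ ψ × (w ⊨ 𝐅 ψ)

FG[_,_] : ∀ {n} → LTL n → Word n → Pred (LTL n) 0ℓ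
FG[ φ , w ] ψ = ν φ ψ × (w ⊨ 𝐅 (𝐆 ψ))

G[_,_] : ∀ {n} → LTL n → Word n → Pred (LTL n) 0ℓ
G[ φ , w ] ψ = ν φ ψ × (w ⊨ 𝐆 ψ)

FSet : ℕ → Set
FSet n = LTL n → Bool

⟦_⟧ : ∀ {n} → FSet n → Pred (LTL n) 0ℓ
⟦ X ⟧ ψ = X ψ ≡ true

_[_]ν : ∀ {n} → LTL n → FSet n → LTL n
tt [ X ]ν = tt
ff [ X ]ν = ff
atom a [ X ]ν = atom a
natom a [ X ]ν = natom a
(φ ∧ ψ) [ X ]ν = (φ [ X ]ν) ∧ (ψ [ X ]ν)
(φ ∨ ψ) [ X ]ν = (φ [ X ]ν) ∨ (ψ [ X ]ν)
𝐗 φ [ X ]ν = 𝐗 (φ [ X ]ν)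
𝐆 φ [ X ]ν = 𝐆 (φ [ X ]ν)
(φ 𝐖 ψ) [ X ]ν = (φ [ X ]ν) 𝐖 (ψ [ X ]ν)
(φ 𝐑 ψ) [ X ]ν = (φ [ X ]ν) 𝐑 (ψ [ X ]ν)
𝐅 φ [ X ]ν = if X (𝐅 φ) then tt else ff
(φ 𝐔 ψ) [ X ]ν = if X (φ 𝐔 ψ) then (φ [ X ]ν) 𝐖 (ψ [ X ]ν) else ff
(φ 𝐌 ψ) [ X ]ν = if X (φ 𝐌 ψ) then (φ [ X ]ν) 𝐑 (ψ [ X ]ν) else ff

_[_]μ : ∀ {n} → LTL n → FSet n → LTL n
tt [ Y ]μ = tt
ff [ Y ]μ = ff
atom a [ Y ]μ = atom a
natom a [ Y ]μ = natom a
(φ ∧ ψ) [ Y ]μ = (φ [ Y ]μ) ∧ (ψ [ Y ]μ)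
(φ ∨ ψ) [ Y ]μ = (φ [ Y ]μ) ∨ (ψ [ Y ]μ)
𝐗 φ [ Y ]μ = 𝐗 (φ [ Y ]μ)
𝐅 φ [ Y ]μ = 𝐅 (φ [ Y ]μ)
(φ 𝐔 ψ) [ Y ]μ = (φ [ Y ]μ) 𝐔 (ψ [ Y ]μ)
(φ 𝐌 ψ) [ Y ]μ = (φ [ Y ]μ) 𝐌 (ψ [ Y ]μ)
𝐆 φ [ Y ]μ = if Y (𝐆 φ) then tt else ff
(φ 𝐖 ψ) [ Y ]μ = if Y (φ 𝐖 ψ) then tt else (φ [ Y ]μ) 𝐔 (ψ [ Y ]μ)
(φ 𝐑 ψ) [ Y ]μ = if Y (φ 𝐑 ψ) then tt else (φ [ Y ]μ) 𝐌 (ψ [ Y ]μ)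

-- In (a1) every μ-subformula that holds
-- somewhere lies in X, so F ψ and ψ₁ U ψ₂ may be weakened to tt and ψ₁ W ψ₂. In (a2) every
-- member of X holds infinitely often; in particular ψ₂ eventually holds when ψ₁ U ψ₂ ∈ X, which
-- turns the weakened ψ₁ W ψ₂ back into ψ₁ U ψ₂. Dually, in (b1) a ν-subformula that holds
-- forever is in Y, and otherwise ψ₁ W ψ₂ is witnessed by ψ₁ U ψ₂; in (b2) the members of Y
-- hold everywhere, which justifies replacing them by tt.
module Submission where

open import Defs
open import Data.Nat using (ℕ; _+_)
open import Data.Nat.Properties using (+-assoc)
open import Data.Fin.Subset using (_∈_)
open import Data.Product using (_×_; _,_; proj₁; proj₂)
open import Data.Sum using (_⊎_; inj₁; inj₂)
open import Data.Bool using (true; false; if_then_else_)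
open import Data.Unit using (tt)
open import Level using (0ℓ)
open import Relation.Unary using (Pred; _⊆_; _⊆′_; _≐_)
open import Relation.Binary.PropositionalEquality using (_≡_; refl; sym; cong; subst)
open import Function.Bundles using (_⇔_; mk⇔)

private
  variable
    n : ℕ
    u v : Word n
    φ ψ χ : LTL n
    P : Pred (LTL n) 0ℓ

⊨-cong : ∀ ψ → (∀ j → u j ≡ v j) → u ⊨ ψ → v ⊨ ψ
⊨-cong tt e p = p
⊨-cong ff e p = p
⊨-cong (atom a) e p = subst (a ∈_) (e 0) p
⊨-cong (natom a) e p a∈v = p (subst (a ∈_) (sym (e 0)) a∈v)
⊨-cong (φ ∧ ψ) e (p , q) = ⊨-cong φ e p , ⊨-cong ψ e q
⊨-cong (φ ∨ ψ) e (inj₁ p) = inj₁ (⊨-cong φ e p)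
⊨-cong (φ ∨ ψ) e (inj₂ q) = inj₂ (⊨-cong ψ e q)
⊨-cong (𝐗 φ) e p = ⊨-cong φ (λ j → e (1 + j)) p
⊨-cong (𝐅 φ) e (k , p) = k , ⊨-cong φ (λ j → e (k + j)) p
⊨-cong (𝐆 φ) e p k = ⊨-cong φ (λ j → e (k + j)) (p k)
⊨-cong (φ 𝐔 ψ) e (k , p , q) =
  k , ⊨-cong ψ (λ j → e (k + j)) p , λ i i<k → ⊨-cong φ (λ j → e (i + j)) (q i i<k)
⊨-cong (φ 𝐖 ψ) e (inj₁ p) = inj₁ (⊨-cong (𝐆 φ) e p)
⊨-cong (φ 𝐖 ψ) e (inj₂ p) = inj₂ (⊨-cong (φ 𝐔 ψ) e p)
⊨-cong (φ 𝐌 ψ) e (k , p , q) =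
  k , ⊨-cong φ (λ j → e (k + j)) p , λ i i≤k → ⊨-cong ψ (λ j → e (i + j)) (q i i≤k)
⊨-cong (φ 𝐑 ψ) e (inj₁ p) = inj₁ (⊨-cong (𝐆 ψ) e p)
⊨-cong (φ 𝐑 ψ) e (inj₂ p) = inj₂ (⊨-cong (φ 𝐌 ψ) e p)

↑-↑⁺ : ∀ ψ (w : Word n) i k → w ↑ (i + k) ⊨ ψ → (w ↑ i) ↑ k ⊨ ψ
↑-↑⁺ ψ w i k = ⊨-cong ψ (λ j → cong w (+-assoc i k j))

↑-↑⁻ : ∀ ψ (w : Word n) i k → (w ↑ i) ↑ k ⊨ ψ → w ↑ (i + k) ⊨ ψ
↑-↑⁻ ψ w i k = ⊨-cong ψ (λ j → cong w (sym (+-assoc i k j)))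

𝐅𝐅⇒𝐅 : ∀ ψ (w : Word n) → w ⊨ 𝐅 (𝐅 ψ) → w ⊨ 𝐅 ψ
𝐅𝐅⇒𝐅 ψ w (i , k , p) = i + k , ↑-↑⁻ ψ w i k p

𝐆⇒𝐆𝐆 : ∀ ψ (w : Word n) → w ⊨ 𝐆 ψ → w ⊨ 𝐆 (𝐆 ψ)
𝐆⇒𝐆𝐆 ψ w g i k = ↑-↑⁺ ψ w i k (g (i + k))

𝐖∧𝐅⇒𝐔 : ∀ φ ψ (w : Word n) → w ⊨ φ 𝐖 ψ → w ⊨ 𝐅 ψ → w ⊨ φ 𝐔 ψ
𝐖∧𝐅⇒𝐔 φ ψ w (inj₁ g) (k , p) = k , p , λ j _ → g j
𝐖∧𝐅⇒𝐔 φ ψ w (inj₂ u) _       = u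

𝐑∧𝐅⇒𝐌 : ∀ φ ψ (w : Word n) → w ⊨ φ 𝐑 ψ → w ⊨ 𝐅 φ → w ⊨ φ 𝐌 ψ
𝐑∧𝐅⇒𝐌 φ ψ w (inj₁ g) (k , p) = k , p , λ j _ → g j
𝐑∧𝐅⇒𝐌 φ ψ w (inj₂ m) _       = m

𝐅𝐔⇒𝐅 : ∀ φ ψ (w : Word n) → w ⊨ 𝐅 (φ 𝐔 ψ) → w ⊨ 𝐅 ψ
𝐅𝐔⇒𝐅 φ ψ w (i , k , p , _) = 𝐅𝐅⇒𝐅 ψ w (i , k , p)

𝐅𝐌⇒𝐅 : ∀ φ ψ (w : Word n) → w ⊨ 𝐅 (φ 𝐌 ψ) → w ⊨ 𝐅 φ
𝐅𝐌⇒𝐅 φ ψ w (i , k , p , _) = 𝐅𝐅⇒𝐅 φ w (i , k , p)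

𝐖-split : ∀ φ ψ (w : Word n) → w ⊨ φ 𝐖 ψ → w ⊨ 𝐆 (φ 𝐖 ψ) ⊎ w ⊨ φ 𝐔 ψ
𝐖-split φ ψ w (inj₁ g) = inj₁ (λ k → inj₁ (𝐆⇒𝐆𝐆 φ w g k))
𝐖-split φ ψ w (inj₂ u) = inj₂ u

𝐑-split : ∀ φ ψ (w : Word n) → w ⊨ φ 𝐑 ψ → w ⊨ 𝐆 (φ 𝐑 ψ) ⊎ w ⊨ φ 𝐌 ψ
𝐑-split φ ψ w (inj₁ g) = inj₁ (λ k → inj₁ (𝐆⇒𝐆𝐆 ψ w g k))
𝐑-split φ ψ w (inj₂ m) = inj₂ m

⊨-if-else-ff⁺ : ∀ b φ (w : Word n) → b ≡ true → w ⊨ φ → w ⊨ (if b then φ else ff)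
⊨-if-else-ff⁺ true φ w _ p = p

⊨-if-else-ff⁻ : ∀ b φ (w : Word n) → w ⊨ (if b then φ else ff) → b ≡ true × w ⊨ φ
⊨-if-else-ff⁻ true φ w p = refl , p

⊨-if-then-tt⁺ : ∀ b ψ (w : Word n) → b ≡ true ⊎ w ⊨ ψ → w ⊨ (if b then tt else ψ)
⊨-if-then-tt⁺ true  ψ w _ = tt
⊨-if-then-tt⁺ false ψ w (inj₂ p) = p

⊨-if-then-tt⁻ : ∀ b ψ (w : Word n) → w ⊨ (if b then tt else ψ) → b ≡ true ⊎ w ⊨ ψ
⊨-if-then-tt⁻ true  ψ w _ = inj₁ refl
⊨-if-then-tt⁻ false ψ w p = inj₂ p

F-restrict : ∀ (v : Word n) i → (∀ {ρ} → ρ ⊑ χ → ρ ⊑ ψ) → F[ ψ , v ] ⊆ P → F[ χ , v ↑ i ] ⊆ P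
F-restrict v i ⊑χ⇒⊑ψ s {ρ} ((ρ⊑χ , μρ) , f) = s ((⊑χ⇒⊑ψ ρ⊑χ , μρ) , 𝐅𝐅⇒𝐅 ρ v (i , f))

FG-restrict : ∀ (v : Word n) i → (∀ {ρ} → ρ ⊑ χ → ρ ⊑ ψ) → FG[ ψ , v ] ⊆ P → FG[ χ , v ↑ i ] ⊆ P
FG-restrict v i ⊑χ⇒⊑ψ s {ρ} ((ρ⊑χ , νρ) , f) = s ((⊑χ⇒⊑ψ ρ⊑χ , νρ) , 𝐅𝐅⇒𝐅 (𝐆 ρ) v (i , f))

Holds𝐆 : Word n → Pred (LTL n) 0ℓ
Holds𝐆 w ψ = w ⊨ 𝐆 ψ

Holds𝐆𝐅 : Word n → Pred (LTL n) 0ℓ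
Holds𝐆𝐅 w ψ = w ⊨ 𝐆 (𝐅 ψ)

Holds𝐆-↑ : ∀ (w : Word n) i → P ⊆′ Holds𝐆 w → P ⊆′ Holds𝐆 (w ↑ i)
Holds𝐆-↑ w i h ψ x = 𝐆⇒𝐆𝐆 ψ w (h ψ x) i

Holds𝐆𝐅-↑ : ∀ (w : Word n) i → P ⊆′ Holds𝐆𝐅 w → P ⊆′ Holds𝐆𝐅 (w ↑ i)
Holds𝐆𝐅-↑ w i h ψ x = 𝐆⇒𝐆𝐆 (𝐅 ψ) w (h ψ x) i

module _ (X : FSet n) where

  ⊨⇒⊨[]ν : ∀ ψ (v : Word n) → F[ ψ , v ] ⊆ ⟦ X ⟧ → v ⊨ ψ → v ⊨ ψ [ X ]ν
  ⊨⇒⊨[]ν tt v s p = p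
  ⊨⇒⊨[]ν ff v s p = p
  ⊨⇒⊨[]ν (atom a) v s p = p
  ⊨⇒⊨[]ν (natom a) v s p = p
  ⊨⇒⊨[]ν (φ ∧ ψ) v s (p , q) =
    ⊨⇒⊨[]ν φ v (F-restrict v 0 ∧ˡ s) p , ⊨⇒⊨[]ν ψ v (F-restrict v 0 ∧ʳ s) q
  ⊨⇒⊨[]ν (φ ∨ ψ) v s (inj₁ p) = inj₁ (⊨⇒⊨[]ν φ v (F-restrict v 0 ∨ˡ s) p)
  ⊨⇒⊨[]ν (φ ∨ ψ) v s (inj₂ q) = inj₂ (⊨⇒⊨[]ν ψ v (F-restrict v 0 ∨ʳ s) q)
  ⊨⇒⊨[]ν (𝐗 φ) v s p = ⊨⇒⊨[]ν φ (v ↑ 1) (F-restrict v 1 𝐗⊑ s) p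
  ⊨⇒⊨[]ν (𝐆 φ) v s p k = ⊨⇒⊨[]ν φ (v ↑ k) (F-restrict v k 𝐆⊑ s) (p k)
  ⊨⇒⊨[]ν (φ 𝐖 ψ) v s (inj₁ p) = inj₁ λ k → ⊨⇒⊨[]ν φ (v ↑ k) (F-restrict v k 𝐖ˡ s) (p k)
  ⊨⇒⊨[]ν (φ 𝐖 ψ) v s (inj₂ (k , p , q)) =
    inj₂ (k , ⊨⇒⊨[]ν ψ (v ↑ k) (F-restrict v k 𝐖ʳ s) p
            , λ j j<k → ⊨⇒⊨[]ν φ (v ↑ j) (F-restrict v j 𝐖ˡ s) (q j j<k))
  ⊨⇒⊨[]ν (φ 𝐑 ψ) v s (inj₁ p) = inj₁ λ k → ⊨⇒⊨[]ν ψ (v ↑ k) (F-restrict v k 𝐑ʳ s) (p k)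
  ⊨⇒⊨[]ν (φ 𝐑 ψ) v s (inj₂ (k , p , q)) =
    inj₂ (k , ⊨⇒⊨[]ν φ (v ↑ k) (F-restrict v k 𝐑ˡ s) p
            , λ j j≤k → ⊨⇒⊨[]ν ψ (v ↑ j) (F-restrict v j 𝐑ʳ s) (q j j≤k))
  ⊨⇒⊨[]ν (𝐅 φ) v s p = ⊨-if-else-ff⁺ (X (𝐅 φ)) tt v (s ((refl⊑ , isF) , 0 , p)) tt
  ⊨⇒⊨[]ν (φ 𝐔 ψ) v s u@(k , p , q) =
    ⊨-if-else-ff⁺ (X (φ 𝐔 ψ)) ((φ 𝐖 ψ) [ X ]ν) v (s ((refl⊑ , isU) , 0 , u))
      (inj₂ (k , ⊨⇒⊨[]ν ψ (v ↑ k) (F-restrict v k 𝐔ʳ s) p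
               , λ j j<k → ⊨⇒⊨[]ν φ (v ↑ j) (F-restrict v j 𝐔ˡ s) (q j j<k)))
  ⊨⇒⊨[]ν (φ 𝐌 ψ) v s m@(k , p , q) =
    ⊨-if-else-ff⁺ (X (φ 𝐌 ψ)) ((φ 𝐑 ψ) [ X ]ν) v (s ((refl⊑ , isM) , 0 , m))
      (inj₂ (k , ⊨⇒⊨[]ν φ (v ↑ k) (F-restrict v k 𝐌ˡ s) p
               , λ j j≤k → ⊨⇒⊨[]ν ψ (v ↑ j) (F-restrict v j 𝐌ʳ s) (q j j≤k)))

  ⊨[]ν⇒⊨ : ∀ ψ (v : Word n) → ⟦ X ⟧ ⊆′ Holds𝐆𝐅 v → v ⊨ ψ [ X ]ν → v ⊨ ψ
  ⊨[]ν⇒⊨-𝐖 : ∀ φ ψ (v : Word n) → ⟦ X ⟧ ⊆′ Holds𝐆𝐅 v → v ⊨ (φ [ X ]ν) 𝐖 (ψ [ X ]ν) → v ⊨ φ 𝐖 ψ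
  ⊨[]ν⇒⊨-𝐑 : ∀ φ ψ (v : Word n) → ⟦ X ⟧ ⊆′ Holds𝐆𝐅 v → v ⊨ (φ [ X ]ν) 𝐑 (ψ [ X ]ν) → v ⊨ φ 𝐑 ψ

  ⊨[]ν⇒⊨ tt v h p = p
  ⊨[]ν⇒⊨ ff v h p = p
  ⊨[]ν⇒⊨ (atom a) v h p = p
  ⊨[]ν⇒⊨ (natom a) v h p = p
  ⊨[]ν⇒⊨ (φ ∧ ψ) v h (p , q) = ⊨[]ν⇒⊨ φ v h p , ⊨[]ν⇒⊨ ψ v h q
  ⊨[]ν⇒⊨ (φ ∨ ψ) v h (inj₁ p) = inj₁ (⊨[]ν⇒⊨ φ v h p)
  ⊨[]ν⇒⊨ (φ ∨ ψ) v h (inj₂ q) = inj₂ (⊨[]ν⇒⊨ ψ v h q)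
  ⊨[]ν⇒⊨ (𝐗 φ) v h p = ⊨[]ν⇒⊨ φ (v ↑ 1) (Holds𝐆𝐅-↑ v 1 h) p
  ⊨[]ν⇒⊨ (𝐆 φ) v h p k = ⊨[]ν⇒⊨ φ (v ↑ k) (Holds𝐆𝐅-↑ v k h) (p k)
  ⊨[]ν⇒⊨ (φ 𝐖 ψ) v h p = ⊨[]ν⇒⊨-𝐖 φ ψ v h p
  ⊨[]ν⇒⊨ (φ 𝐑 ψ) v h p = ⊨[]ν⇒⊨-𝐑 φ ψ v h p
  ⊨[]ν⇒⊨ (𝐅 φ) v h p =
    let inX , _ = ⊨-if-else-ff⁻ (X (𝐅 φ)) tt v p in 𝐅𝐅⇒𝐅 φ v (h _ inX 0)
  ⊨[]ν⇒⊨ (φ 𝐔 ψ) v h p =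
    let inX , p′ = ⊨-if-else-ff⁻ (X (φ 𝐔 ψ)) ((φ 𝐖 ψ) [ X ]ν) v p
    in 𝐖∧𝐅⇒𝐔 φ ψ v (⊨[]ν⇒⊨-𝐖 φ ψ v h p′) (𝐅𝐔⇒𝐅 φ ψ v (h _ inX 0))
  ⊨[]ν⇒⊨ (φ 𝐌 ψ) v h p =
    let inX , p′ = ⊨-if-else-ff⁻ (X (φ 𝐌 ψ)) ((φ 𝐑 ψ) [ X ]ν) v p
    in 𝐑∧𝐅⇒𝐌 φ ψ v (⊨[]ν⇒⊨-𝐑 φ ψ v h p′) (𝐅𝐌⇒𝐅 φ ψ v (h _ inX 0))

  ⊨[]ν⇒⊨-𝐖 φ ψ v h (inj₁ p) = inj₁ λ k → ⊨[]ν⇒⊨ φ (v ↑ k) (Holds𝐆𝐅-↑ v k h) (p k)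
  ⊨[]ν⇒⊨-𝐖 φ ψ v h (inj₂ (k , p , q)) =
    inj₂ (k , ⊨[]ν⇒⊨ ψ (v ↑ k) (Holds𝐆𝐅-↑ v k h) p
            , λ j j<k → ⊨[]ν⇒⊨ φ (v ↑ j) (Holds𝐆𝐅-↑ v j h) (q j j<k))

  ⊨[]ν⇒⊨-𝐑 φ ψ v h (inj₁ p) = inj₁ λ k → ⊨[]ν⇒⊨ ψ (v ↑ k) (Holds𝐆𝐅-↑ v k h) (p k)
  ⊨[]ν⇒⊨-𝐑 φ ψ v h (inj₂ (k , p , q)) =
    inj₂ (k , ⊨[]ν⇒⊨ φ (v ↑ k) (Holds𝐆𝐅-↑ v k h) p
            , λ j j≤k → ⊨[]ν⇒⊨ ψ (v ↑ j) (Holds𝐆𝐅-↑ v j h) (q j j≤k))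

module _ (Y : FSet n) where

  ⊨⇒⊨[]μ : ∀ ψ (v : Word n) → FG[ ψ , v ] ⊆ ⟦ Y ⟧ → v ⊨ ψ → v ⊨ ψ [ Y ]μ
  ⊨⇒⊨[]μ tt v s p = p
  ⊨⇒⊨[]μ ff v s p = p
  ⊨⇒⊨[]μ (atom a) v s p = p
  ⊨⇒⊨[]μ (natom a) v s p = p
  ⊨⇒⊨[]μ (φ ∧ ψ) v s (p , q) =
    ⊨⇒⊨[]μ φ v (FG-restrict v 0 ∧ˡ s) p , ⊨⇒⊨[]μ ψ v (FG-restrict v 0 ∧ʳ s) q
  ⊨⇒⊨[]μ (φ ∨ ψ) v s (inj₁ p) = inj₁ (⊨⇒⊨[]μ φ v (FG-restrict v 0 ∨ˡ s) p)
  ⊨⇒⊨[]μ (φ ∨ ψ) v s (inj₂ q) = inj₂ (⊨⇒⊨[]μ ψ v (FG-restrict v 0 ∨ʳ s) q)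
  ⊨⇒⊨[]μ (𝐗 φ) v s p = ⊨⇒⊨[]μ φ (v ↑ 1) (FG-restrict v 1 𝐗⊑ s) p
  ⊨⇒⊨[]μ (𝐅 φ) v s (k , p) = k , ⊨⇒⊨[]μ φ (v ↑ k) (FG-restrict v k 𝐅⊑ s) p
  ⊨⇒⊨[]μ (φ 𝐔 ψ) v s (k , p , q) =
    k , ⊨⇒⊨[]μ ψ (v ↑ k) (FG-restrict v k 𝐔ʳ s) p
      , λ j j<k → ⊨⇒⊨[]μ φ (v ↑ j) (FG-restrict v j 𝐔ˡ s) (q j j<k)
  ⊨⇒⊨[]μ (φ 𝐌 ψ) v s (k , p , q) =
    k , ⊨⇒⊨[]μ φ (v ↑ k) (FG-restrict v k 𝐌ˡ s) p
      , λ j j≤k → ⊨⇒⊨[]μ ψ (v ↑ j) (FG-restrict v j 𝐌ʳ s) (q j j≤k)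
  ⊨⇒⊨[]μ (𝐆 φ) v s p = ⊨-if-else-ff⁺ (Y (𝐆 φ)) tt v (s ((refl⊑ , isG) , 0 , 𝐆⇒𝐆𝐆 φ v p)) tt
  ⊨⇒⊨[]μ (φ 𝐖 ψ) v s p with 𝐖-split φ ψ v p
  ... | inj₁ g = ⊨-if-then-tt⁺ (Y (φ 𝐖 ψ)) ((φ 𝐔 ψ) [ Y ]μ) v (inj₁ (s ((refl⊑ , isW) , 0 , g)))
  ... | inj₂ (k , p , q) = ⊨-if-then-tt⁺ (Y (φ 𝐖 ψ)) ((φ 𝐔 ψ) [ Y ]μ) v
    (inj₂ (k , ⊨⇒⊨[]μ ψ (v ↑ k) (FG-restrict v k 𝐖ʳ s) p
             , λ j j<k → ⊨⇒⊨[]μ φ (v ↑ j) (FG-restrict v j 𝐖ˡ s) (q j j<k)))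
  ⊨⇒⊨[]μ (φ 𝐑 ψ) v s p with 𝐑-split φ ψ v p
  ... | inj₁ g = ⊨-if-then-tt⁺ (Y (φ 𝐑 ψ)) ((φ 𝐌 ψ) [ Y ]μ) v (inj₁ (s ((refl⊑ , isR) , 0 , g)))
  ... | inj₂ (k , p , q) = ⊨-if-then-tt⁺ (Y (φ 𝐑 ψ)) ((φ 𝐌 ψ) [ Y ]μ) v
    (inj₂ (k , ⊨⇒⊨[]μ φ (v ↑ k) (FG-restrict v k 𝐑ˡ s) p
             , λ j j≤k → ⊨⇒⊨[]μ ψ (v ↑ j) (FG-restrict v j 𝐑ʳ s) (q j j≤k)))

  ⊨[]μ⇒⊨ : ∀ ψ (v : Word n) → ⟦ Y ⟧ ⊆′ Holds𝐆 v → v ⊨ ψ [ Y ]μ → v ⊨ ψ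
  ⊨[]μ⇒⊨-𝐔 : ∀ φ ψ (v : Word n) → ⟦ Y ⟧ ⊆′ Holds𝐆 v → v ⊨ (φ [ Y ]μ) 𝐔 (ψ [ Y ]μ) → v ⊨ φ 𝐔 ψ
  ⊨[]μ⇒⊨-𝐌 : ∀ φ ψ (v : Word n) → ⟦ Y ⟧ ⊆′ Holds𝐆 v → v ⊨ (φ [ Y ]μ) 𝐌 (ψ [ Y ]μ) → v ⊨ φ 𝐌 ψ

  ⊨[]μ⇒⊨ tt v h p = p
  ⊨[]μ⇒⊨ ff v h p = p
  ⊨[]μ⇒⊨ (atom a) v h p = p
  ⊨[]μ⇒⊨ (natom a) v h p = p
  ⊨[]μ⇒⊨ (φ ∧ ψ) v h (p , q) = ⊨[]μ⇒⊨ φ v h p , ⊨[]μ⇒⊨ ψ v h q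
  ⊨[]μ⇒⊨ (φ ∨ ψ) v h (inj₁ p) = inj₁ (⊨[]μ⇒⊨ φ v h p)
  ⊨[]μ⇒⊨ (φ ∨ ψ) v h (inj₂ q) = inj₂ (⊨[]μ⇒⊨ ψ v h q)
  ⊨[]μ⇒⊨ (𝐗 φ) v h p = ⊨[]μ⇒⊨ φ (v ↑ 1) (Holds𝐆-↑ v 1 h) p
  ⊨[]μ⇒⊨ (𝐅 φ) v h (k , p) = k , ⊨[]μ⇒⊨ φ (v ↑ k) (Holds𝐆-↑ v k h) p
  ⊨[]μ⇒⊨ (φ 𝐔 ψ) v h p = ⊨[]μ⇒⊨-𝐔 φ ψ v h p
  ⊨[]μ⇒⊨ (φ 𝐌 ψ) v h p = ⊨[]μ⇒⊨-𝐌 φ ψ v h p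
  ⊨[]μ⇒⊨ (𝐆 φ) v h p =
    let inY , _ = ⊨-if-else-ff⁻ (Y (𝐆 φ)) tt v p in h _ inY 0
  ⊨[]μ⇒⊨ (φ 𝐖 ψ) v h p with ⊨-if-then-tt⁻ (Y (φ 𝐖 ψ)) ((φ 𝐔 ψ) [ Y ]μ) v p
  ... | inj₁ inY = h _ inY 0
  ... | inj₂ u = inj₂ (⊨[]μ⇒⊨-𝐔 φ ψ v h u)
  ⊨[]μ⇒⊨ (φ 𝐑 ψ) v h p with ⊨-if-then-tt⁻ (Y (φ 𝐑 ψ)) ((φ 𝐌 ψ) [ Y ]μ) v p
  ... | inj₁ inY = h _ inY 0
  ... | inj₂ m = inj₂ (⊨[]μ⇒⊨-𝐌 φ ψ v h m)

  ⊨[]μ⇒⊨-𝐔 φ ψ v h (k , p , q) =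
    k , ⊨[]μ⇒⊨ ψ (v ↑ k) (Holds𝐆-↑ v k h) p , λ j j<k → ⊨[]μ⇒⊨ φ (v ↑ j) (Holds𝐆-↑ v j h) (q j j<k)

  ⊨[]μ⇒⊨-𝐌 φ ψ v h (k , p , q) =
    k , ⊨[]μ⇒⊨ φ (v ↑ k) (Holds𝐆-↑ v k h) p , λ j j≤k → ⊨[]μ⇒⊨ ψ (v ↑ j) (Holds𝐆-↑ v j h) (q j j≤k)

lemma5p8 : ∀ {n : ℕ} (φ : LTL n) (w : Word n) →
    (∀ (X : FSet n) → ⟦ X ⟧ ⊆ μ φ →
        (F[ φ , w ] ⊆ ⟦ X ⟧ → w ⊨ φ → w ⊨ φ [ X ]ν)
      × (⟦ X ⟧ ⊆ GF[ φ , w ] → w ⊨ φ [ X ]ν → w ⊨ φ)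
      × (F[ φ , w ] ≐ ⟦ X ⟧ → ⟦ X ⟧ ≐ GF[ φ , w ] → (w ⊨ φ) ⇔ (w ⊨ φ [ X ]ν)))
    × (∀ (Y : FSet n) → ⟦ Y ⟧ ⊆ ν φ →
        (FG[ φ , w ] ⊆ ⟦ Y ⟧ → w ⊨ φ → w ⊨ φ [ Y ]μ)
      × (⟦ Y ⟧ ⊆ G[ φ , w ] → w ⊨ φ [ Y ]μ → w ⊨ φ)
      × (FG[ φ , w ] ≐ ⟦ Y ⟧ → ⟦ Y ⟧ ≐ G[ φ , w ] → (w ⊨ φ) ⇔ (w ⊨ φ [ Y ]μ)))
lemma5p8 φ w = (λ X _ → a1 X , a2 X , λ F≐X X≐GF → mk⇔ (a1 X (proj₁ F≐X)) (a2 X (proj₁ X≐GF)))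
             , (λ Y _ → b1 Y , b2 Y , λ FG≐Y Y≐G → mk⇔ (b1 Y (proj₁ FG≐Y)) (b2 Y (proj₁ Y≐G)))
  where
  a1 : ∀ X → F[ φ , w ] ⊆ ⟦ X ⟧ → w ⊨ φ → w ⊨ φ [ X ]ν
  a1 X = ⊨⇒⊨[]ν X φ w
  a2 : ∀ X → ⟦ X ⟧ ⊆ GF[ φ , w ] → w ⊨ φ [ X ]ν → w ⊨ φ
  a2 X X⊆GF = ⊨[]ν⇒⊨ X φ w (λ _ x → proj₂ (X⊆GF x))
  b1 : ∀ Y → FG[ φ , w ] ⊆ ⟦ Y ⟧ → w ⊨ φ → w ⊨ φ [ Y ]μ
  b1 Y = ⊨⇒⊨[]μ Y φ w
  b2 : ∀ Y → ⟦ Y ⟧ ⊆ G[ φ , w ] → w ⊨ φ [ Y ]μ → w ⊨ φ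
  b2 Y Y⊆G = ⊨[]μ⇒⊨ Y φ w (λ _ y → proj₂ (Y⊆G y))
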